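{- Let $a,b,c,d \geq 0$ be integers. If $(A_i,B_i)_{i \in I}$ is an $(a,b)$ set system, then $u_s(a+c,b+d) \geq |I|\,u_s(c,d) + |\bigcup_{i \in I} B_i|$. If $(A_i,B_i)_{i \in I}$ is an $(a,b)$ vector space system, then $u_v(a+c,b+d) \geq |I|\,u_v(c,d) + \dim\left(\sum_{i \in I} B_i\right)$.
   Context: $F$ is a fixed infinite field; vector spaces are finite-dimensional over $F$ and within a system are subspaces of a common ambient space. Index sets are finite totally ordered sets. An $(a,b)$ set system is a sequence $(A_i,B_i)_{i\in I}$ of pairs of finite sets with $|A_i|\le a$, $|B_i|\le b$, $A_i\cap B_i=\emptyset$ for all $i$, and $A_i\cap B_j\ne\emptyset$ for all $i<j$. An $(a,b)$ vector space system is the same with subspaces, dimension in place of cardinality, and $0$ in place of $\emptyset$. $u_s(a,b)$ (resp. $u_v(a,b)$) is the maximum of $|\bigcup_i B_i|$ (resp. $\dim\sum_i B_i$) over all $(a,b)$ set (resp. vector space) systems. -}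

module Defs where

open import Level using (Level; _⊔_) renaming (suc to lsuc)
open import Data.Nat using (ℕ; _≤_)
open import Data.Fin using (Fin; zero; suc) renaming (_<_ to _<ᶠ_)
open import Data.Fin.Subset using (Subset; ∣_∣; _∩_; ⋃; Empty; Nonempty)
open import Data.List using (List; []; _∷_; length; concat; tabulate)
open import Data.List.Relation.Unary.All using (All)
open import Data.Product using (Σ; ∃; _×_; _,_)
open import Relation.Nullary using (¬_)
open import Relation.Binary.PropositionalEquality using (_≡_)
open import Algebra.Bundles using (CommutativeRing)

-- Set systems.  A finite set is a subset of some finite ground set Fin m;
-- the index set I is Fin N with its natural order.

IsSetSystem : ℕ → ℕ → {m N : ℕ} → (A B : Fin N → Subset m) → Set
IsSetSystem a b A B =
  (∀ i → ∣ A i ∣ ≤ a) × (∀ i → ∣ B i ∣ ≤ b) ×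
  (∀ i → Empty (A i ∩ B i)) ×
  (∀ i j → i <ᶠ j → Nonempty (A i ∩ B j))

⋃B : {m N : ℕ} → (Fin N → Subset m) → Subset m
⋃B B = ⋃ (tabulate B)

IsUs : ℕ → ℕ → ℕ → Set
IsUs a b u =
  (∃ λ m → ∃ λ N → Σ (Fin N → Subset m) λ A → Σ (Fin N → Subset m) λ B →
     IsSetSystem a b A B × ∣ ⋃B B ∣ ≡ u) ×
  (∀ {m N} (A B : Fin N → Subset m) → IsSetSystem a b A B → ∣ ⋃B B ∣ ≤ u)

record Field (c ℓ : Level) : Set (lsuc (c ⊔ ℓ)) where
  field
    commutativeRing : CommutativeRing c ℓ
  open CommutativeRing commutativeRing public
  field
    1≉0     : ¬ (1# ≈ 0#)
    inverse : ∀ x → ¬ (x ≈ 0#) → ∃ λ y → (x * y) ≈ 1#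

IsInfinite : ∀ {c ℓ} → Field c ℓ → Set (c ⊔ ℓ)
IsInfinite F = Σ (ℕ → Carrier) λ f → ∀ m n → f m ≈ f n → m ≡ n
  where open Field F

-- Vector spaces over F.  Ambient space F^n (vectors = functions Fin n → F);
-- a subspace is given by a finite list of generators (its span).

module VectorSpaces {c ℓ} (F : Field c ℓ) where
  open Field F using (Carrier; _≈_; _+_; _*_; 0#)

  V : ℕ → Set c
  V n = Fin n → Carrier

  _≋_ : ∀ {n} → V n → V n → Set ℓ
  u ≋ v = ∀ k → u k ≈ v k

  0V : ∀ {n} → V n
  0V _ = 0#

  _+V_ : ∀ {n} → V n → V n → V n
  (u +V v) k = u k + v k

  _·V_ : ∀ {n} → Carrier → V n → V n
  (x ·V v) k = x * v k

  lc : ∀ {n} (gs : List (V n)) → (Fin (length gs) → Carrier) → V n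
  lc []       cs = 0V
  lc (g ∷ gs) cs = (cs zero ·V g) +V lc gs (λ j → cs (suc j))

  Subspace : ℕ → Set c
  Subspace n = List (V n)

  _∈S_ : ∀ {n} → V n → Subspace n → Set (c ⊔ ℓ)
  v ∈S U = Σ (Fin (length U) → Carrier) λ cs → lc U cs ≋ v

  LinIndep : ∀ {n} → List (V n) → Set (c ⊔ ℓ)
  LinIndep L = ∀ cs → lc L cs ≋ 0V → ∀ j → cs j ≈ 0#

  HasDim : ∀ {n} → Subspace n → ℕ → Set (c ⊔ ℓ)
  HasDim U k = Σ (List (V _)) λ L →
    length L ≡ k × LinIndep L × All (_∈S U) L × All (_∈S L) U

  DimLe : ∀ {n} → Subspace n → ℕ → Set (c ⊔ ℓ)
  DimLe U a = ∃ λ k → HasDim U k × k ≤ a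

  TrivialMeet : ∀ {n} → Subspace n → Subspace n → Set (c ⊔ ℓ)
  TrivialMeet U W = ∀ v → v ∈S U → v ∈S W → v ≋ 0V

  NontrivialMeet : ∀ {n} → Subspace n → Subspace n → Set (c ⊔ ℓ)
  NontrivialMeet U W = ∃ λ v → v ∈S U × v ∈S W × ¬ (v ≋ 0V)

  ΣS : ∀ {n N} → (Fin N → Subspace n) → Subspace n
  ΣS B = concat (tabulate B)

  IsVecSystem : ℕ → ℕ → {n N : ℕ} → (A B : Fin N → Subspace n) → Set (c ⊔ ℓ)
  IsVecSystem a b A B =
    (∀ i → DimLe (A i) a) × (∀ i → DimLe (B i) b) ×
    (∀ i → TrivialMeet (A i) (B i)) ×
    (∀ i j → i <ᶠ j → NontrivialMeet (A i) (B j))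

  IsUv : ℕ → ℕ → ℕ → Set (c ⊔ ℓ)
  IsUv a b u =
    (∃ λ n → ∃ λ N → Σ (Fin N → Subspace n) λ A → Σ (Fin N → Subspace n) λ B →
       IsVecSystem a b A B × HasDim (ΣS B) u) ×
    (∀ {n N} (A B : Fin N → Subspace n) → IsVecSystem a b A B →
       ∀ k → HasDim (ΣS B) k → k ≤ u)

{-# OPTIONS --safe #-}
-- Take an (a,b) system (A i , B i), i < N, and a (c,d) system (A′ j , B′ j), j < N′, attaining
-- u(c,d).  Index the pairs (i , j) lexicographically and take A i ⊔ A′ j and B i ⊔ B′ j, where for
-- each i the second system is placed in a fresh copy of its ground set (for vector spaces: a fresh
-- direct summand).  For i < i′ the required intersection comes from the first system, for i = i′
-- and j < j′ from the i-th copy of the second, and disjointness holds componentwise.  The new B's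
-- cover ⋃ B i together with N independent copies of ⋃ B′ j, of total size |⋃ B i| + N·u(c,d).
-- An empty extremal (c,d) system forces u(c,d) = 0, and then the first system itself suffices.
module Submission where

open import Defs
open import Level using (_⊔_)
open import Data.Nat using (ℕ; zero; suc; _+_; _*_; _≤_; _<_)
import Data.Nat.Properties as ℕ
open import Data.Bool using (true; false)
open import Data.Empty using (⊥-elim)
open import Data.Fin as Fin using (Fin; zero; suc; _↑ˡ_; _↑ʳ_; combine; remQuot; splitAt)
import Data.Fin.Properties as Fin
open import Data.Fin.Subset as Subset using (Subset; ∣_∣; _∈_; _∩_; ⋃; ⊥; Empty; Nonempty; _⊆_)
import Data.Fin.Subset.Properties as Subset
open import Data.Vec as Vec using ([]; _∷_; _++_)
open Vec._[_]=_ using (here; there)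
import Data.Vec.Properties as Vec
open import Data.List as List using (List; tabulate)
open import Data.List.Relation.Unary.All as All using (All; []; _∷_)
import Data.List.Relation.Unary.All.Properties as Allₚ
import Data.List.Properties as Listₚ
open import Data.List.Membership.Propositional as List using ()
import Data.List.Membership.Propositional.Properties as List
import Data.List.Relation.Unary.Any as Any
open import Data.Product using (∃; _×_; _,_; proj₁; proj₂; uncurry)
open import Data.Product.Relation.Binary.Lex.Strict using (×-Lex)
open import Data.Sum using (_⊎_; inj₁; inj₂)
open import Relation.Binary.PropositionalEquality
open import Relation.Nullary using (Dec; yes; no)
open import Function using (_∘_; id; const)
open import Data.Vec.Functional using () renaming (_++_ to _++ᵛ_)
import Data.Vec.Functional.Properties as Vecᶠ
open import Relation.Binary.Definitions using (tri<; tri≈; tri>)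

private variable m n : ℕ

_<ₗₑₓ_ : ∀ {N N′} → Fin N × Fin N′ → Fin N × Fin N′ → Set
_<ₗₑₓ_ = ×-Lex _≡_ Fin._<_ Fin._<_

combine-<⇒<ₗₑₓ : ∀ {N N′} {i i′ : Fin N} {j j′ : Fin N′} →
                 combine i j Fin.< combine i′ j′ → (i , j) <ₗₑₓ (i′ , j′)
combine-<⇒<ₗₑₓ {N′ = N′} {i} {i′} {j} {j′} ij<i′j′ with Fin.<-cmp i i′
... | tri< i<i′ _ _ = inj₁ i<i′
... | tri> _ _ i>i′ = ⊥-elim (Fin.<-asym ij<i′j′ (Fin.combine-monoˡ-< j′ j i>i′))
... | tri≈ _ refl _ = inj₂ (refl , ℕ.+-cancelˡ-< (N′ * Fin.toℕ i) _ _
  (subst₂ _<_ (Fin.toℕ-combine i j) (Fin.toℕ-combine i j′) ij<i′j′))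

remQuot-<⇒<ₗₑₓ : ∀ {N} N′ {x y : Fin (N * N′)} → x Fin.< y → remQuot N′ x <ₗₑₓ remQuot N′ y
remQuot-<⇒<ₗₑₓ {N} N′ {x} {y} =
  combine-<⇒<ₗₑₓ {N} {N′} {proj₁ (remQuot N′ x)} {proj₁ (remQuot N′ y)} ∘
  subst₂ Fin._<_ (sym (Fin.combine-remQuot {N} N′ x)) (sym (Fin.combine-remQuot {N} N′ y))

flatten : ∀ {a} {X : Set a} {N N′} → (Fin N → Fin N′ → X) → Fin (N * N′) → X
flatten {N′ = N′} S x = uncurry S (remQuot N′ x)

flatten-combine : ∀ {a} {X : Set a} {N N′} (S : Fin N → Fin N′ → X) i j → flatten S (combine i j) ≡ S i j
flatten-combine S i j = cong (uncurry S) (Fin.remQuot-combine i j)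

flatten-ordered : ∀ {a b r} {X : Set a} {Y : Set b} {R : X → Y → Set r} {N N′}
                  (S : Fin N → Fin N′ → X) (T : Fin N → Fin N′ → Y) →
                  (∀ {p q} → p <ₗₑₓ q → R (uncurry S p) (uncurry T q)) →
                  ∀ x y → x Fin.< y → R (flatten S x) (flatten T y)
flatten-ordered {N = N} {N′} S T ordered x y x<y = ordered (remQuot-<⇒<ₗₑₓ {N} N′ x<y)

x∈p⇒x↑ˡ∈p++q : ∀ {p : Subset m} {q : Subset n} {x} → x ∈ p → x ↑ˡ n ∈ p ++ q
x∈p⇒x↑ˡ∈p++q here      = here
x∈p⇒x↑ˡ∈p++q (there x∈p) = there (x∈p⇒x↑ˡ∈p++q x∈p)

x∈q⇒m↑ʳx∈p++q : ∀ (p : Subset m) {q : Subset n} {x} → x ∈ q → m ↑ʳ x ∈ p ++ q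
x∈q⇒m↑ʳx∈p++q []      x∈q = x∈q
x∈q⇒m↑ʳx∈p++q (_ ∷ p) x∈q = there (x∈q⇒m↑ʳx∈p++q p x∈q)

x∈p++q⁻ : ∀ (p : Subset m) {q : Subset n} x → x ∈ p ++ q →
          (∃ λ y → x ≡ y ↑ˡ n × y ∈ p) ⊎ (∃ λ z → x ≡ m ↑ʳ z × z ∈ q)
x∈p++q⁻ []      x       x∈q        = inj₂ (x , refl , x∈q)
x∈p++q⁻ (_ ∷ p) zero    here       = inj₁ (zero , refl , here)
x∈p++q⁻ (_ ∷ p) (suc x) (there x∈) with x∈p++q⁻ p x x∈
... | inj₁ (y , refl , y∈p) = inj₁ (suc y , refl , there y∈p)
... | inj₂ (z , refl , z∈q) = inj₂ (z , refl , z∈q)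

∣p++q∣≡∣p∣+∣q∣ : ∀ (p : Subset m) (q : Subset n) → ∣ p ++ q ∣ ≡ ∣ p ∣ + ∣ q ∣
∣p++q∣≡∣p∣+∣q∣ []          q = refl
∣p++q∣≡∣p∣+∣q∣ (true ∷ p)  q = cong suc (∣p++q∣≡∣p∣+∣q∣ p q)
∣p++q∣≡∣p∣+∣q∣ (false ∷ p) q = ∣p++q∣≡∣p∣+∣q∣ p q

++-∩ : ∀ (p r : Subset m) (q s : Subset n) → (p ++ q) ∩ (r ++ s) ≡ (p ∩ r) ++ (q ∩ s)
++-∩ p r q s = Vec.zipWith-++ _ p q r s

⊥++⊥ : ∀ {m n} → ⊥ {m} ++ ⊥ {n} ≡ ⊥
⊥++⊥ {zero}  = refl
⊥++⊥ {suc m} = cong (false ∷_) (⊥++⊥ {m})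

Empty-⊥ : ∀ {n} → Empty (⊥ {n})
Empty-⊥ (_ , x∈⊥) = Subset.∉⊥ x∈⊥

inBlock : ∀ {m K} → Fin K → Subset m → Subset (K * m)
inBlock {K = suc K} zero    s = s ++ ⊥
inBlock {K = suc K} (suc i) s = ⊥ ++ inBlock i s

∣inBlock∣ : ∀ {m K} (i : Fin K) (s : Subset m) → ∣ inBlock i s ∣ ≡ ∣ s ∣
∣inBlock∣ {m} {suc K} zero s = begin
  ∣ s ++ ⊥ ∣            ≡⟨ ∣p++q∣≡∣p∣+∣q∣ s ⊥ ⟩
  ∣ s ∣ + ∣ ⊥ {K * m} ∣ ≡⟨ cong (∣ s ∣ +_) (Subset.∣⊥∣≡0 (K * m)) ⟩
  ∣ s ∣ + 0             ≡⟨ ℕ.+-identityʳ ∣ s ∣ ⟩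
  ∣ s ∣                 ∎
  where open ≡-Reasoning
∣inBlock∣ {m} {suc K} (suc i) s = begin
  ∣ ⊥ {m} ++ inBlock i s ∣    ≡⟨ ∣p++q∣≡∣p∣+∣q∣ (⊥ {m}) (inBlock i s) ⟩
  ∣ ⊥ {m} ∣ + ∣ inBlock i s ∣ ≡⟨ cong (_+ ∣ inBlock i s ∣) (Subset.∣⊥∣≡0 m) ⟩
  ∣ inBlock i s ∣             ≡⟨ ∣inBlock∣ i s ⟩
  ∣ s ∣                       ∎
  where open ≡-Reasoning

inBlock-∩ : ∀ {m K} (i : Fin K) (p q : Subset m) → inBlock i p ∩ inBlock i q ≡ inBlock i (p ∩ q)
inBlock-∩ {K = suc K} zero p q =
  trans (++-∩ p q ⊥ ⊥) (cong ((p ∩ q) ++_) (Subset.∩-idem ⊥))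
inBlock-∩ {K = suc K} (suc i) p q =
  trans (++-∩ ⊥ ⊥ (inBlock i p) (inBlock i q)) (cong₂ _++_ (Subset.∩-idem ⊥) (inBlock-∩ i p q))

inBlock-⊥ : ∀ {m K} (i : Fin K) → inBlock i (⊥ {m}) ≡ ⊥
inBlock-⊥ {m} {suc K} zero    = ⊥++⊥ {m}
inBlock-⊥ {m} {suc K} (suc i) = trans (cong (⊥ ++_) (inBlock-⊥ i)) (⊥++⊥ {m})

x∈s⇒combine∈inBlock : ∀ {m K} (i : Fin K) {s : Subset m} {x} → x ∈ s → combine i x ∈ inBlock i s
x∈s⇒combine∈inBlock {K = suc K} zero    x∈s = x∈p⇒x↑ˡ∈p++q x∈s
x∈s⇒combine∈inBlock {K = suc K} (suc i) x∈s = x∈q⇒m↑ʳx∈p++q ⊥ (x∈s⇒combine∈inBlock i x∈s)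

copies : ∀ {m} K → Subset m → Subset (K * m)
copies zero    s = []
copies (suc K) s = s ++ copies K s

∣copies∣ : ∀ {m} K (s : Subset m) → ∣ copies K s ∣ ≡ K * ∣ s ∣
∣copies∣ zero    s = refl
∣copies∣ {m} (suc K) s = trans (∣p++q∣≡∣p∣+∣q∣ s (copies K s)) (cong (∣ s ∣ +_) (∣copies∣ {m} K s))

x∈copies⁻ : ∀ {m} K (s : Subset m) x → x ∈ copies K s →
            ∃ λ (i : Fin K) → ∃ λ y → x ≡ combine i y × y ∈ s
x∈copies⁻ {m} (suc K) s x x∈ with x∈p++q⁻ s x x∈
... | inj₁ (y , x≡ , y∈s) = zero , y , x≡ , y∈s
... | inj₂ (z , refl , z∈) with x∈copies⁻ K s z z∈
...   | i , y , refl , y∈s = suc i , y , refl , y∈s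

x∈⋃⁻ : ∀ (ps : List (Subset n)) {x} → x ∈ ⋃ ps → ∃ λ p → p List.∈ ps × x ∈ p
x∈⋃⁻ List.[]       x∈⊥ = ⊥-elim (Subset.∉⊥ x∈⊥)
x∈⋃⁻ (p List.∷ ps) x∈  with Subset.x∈p∪q⁻ p (⋃ ps) x∈
... | inj₁ x∈p = p , Any.here refl , x∈p
... | inj₂ x∈⋃ with x∈⋃⁻ ps x∈⋃
...   | q , q∈ps , x∈q = q , Any.there q∈ps , x∈q

x∈⋃⁺ : ∀ {ps : List (Subset n)} {p x} → p List.∈ ps → x ∈ p → x ∈ ⋃ ps
x∈⋃⁺ {ps = p List.∷ ps} (Any.here refl)  x∈p = Subset.x∈p∪q⁺ (inj₁ x∈p)
x∈⋃⁺ {ps = p List.∷ ps} (Any.there q∈ps) x∈q = Subset.x∈p∪q⁺ {p = p} (inj₂ (x∈⋃⁺ q∈ps x∈q))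

x∈⋃B⁻ : ∀ {N} (B : Fin N → Subset n) {x} → x ∈ ⋃B B → ∃ λ i → x ∈ B i
x∈⋃B⁻ B x∈ with x∈⋃⁻ (tabulate B) x∈
... | _ , p∈ , x∈p with List.∈-tabulate⁻ p∈
...   | i , refl = i , x∈p

x∈⋃B⁺ : ∀ {N} (B : Fin N → Subset n) i {x} → x ∈ B i → x ∈ ⋃B B
x∈⋃B⁺ B i = x∈⋃⁺ (List.∈-tabulate⁺ i)

IsSetSystem-weaken : ∀ {a b c d m N} {A B : Fin N → Subset m} →
                     IsSetSystem a b A B → IsSetSystem (a + c) (b + d) A B
IsSetSystem-weaken {a} {b} {c} {d} (∣A∣≤ , ∣B∣≤ , disjoint , meet) =
  (λ i → ℕ.≤-trans (∣A∣≤ i) (ℕ.m≤m+n a c)) , (λ i → ℕ.≤-trans (∣B∣≤ i) (ℕ.m≤m+n b d)) , disjoint , meet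

module SetSystemProduct {m N m′ N′} (A B : Fin N → Subset m) (A′ B′ : Fin N′ → Subset m′) where

  _⊎[_]_ : Subset m → Fin N → Subset m′ → Subset (m + N * m′)
  p ⊎[ i ] q = p ++ inBlock i q

  Aᵢⱼ Bᵢⱼ : Fin N → Fin N′ → Subset (m + N * m′)
  Aᵢⱼ i j = A i ⊎[ i ] A′ j
  Bᵢⱼ i j = B i ⊎[ i ] B′ j

  A⊗ B⊗ : Fin (N * N′) → Subset (m + N * m′)
  A⊗ = flatten Aᵢⱼ
  B⊗ = flatten Bᵢⱼ

  ∣⊎[]∣≤ : ∀ {k l} p i q → ∣ p ∣ ≤ k → ∣ q ∣ ≤ l → ∣ p ⊎[ i ] q ∣ ≤ k + l
  ∣⊎[]∣≤ p i q ∣p∣≤k ∣q∣≤l rewrite ∣p++q∣≡∣p∣+∣q∣ p (inBlock i q) | ∣inBlock∣ i q =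
    ℕ.+-mono-≤ ∣p∣≤k ∣q∣≤l

  ⊎[]-∩ : ∀ p r i q s → (p ⊎[ i ] q) ∩ (r ⊎[ i ] s) ≡ (p ∩ r) ⊎[ i ] (q ∩ s)
  ⊎[]-∩ p r i q s = trans (++-∩ p r (inBlock i q) (inBlock i s)) (cong ((p ∩ r) ++_) (inBlock-∩ i q s))

  Empty-⊎[] : ∀ {p i q} → Empty p → Empty q → Empty (p ⊎[ i ] q)
  Empty-⊎[] {i = i} ∅p ∅q
    rewrite Subset.Empty-unique ∅p | Subset.Empty-unique ∅q | inBlock-⊥ {m′} i | ⊥++⊥ {m} {N * m′} = Empty-⊥

  module _ {a b c d} (AB : IsSetSystem a b A B) (AB′ : IsSetSystem c d A′ B′) where
    private
      ∣A∣≤ = proj₁ AB ; ∣B∣≤ = proj₁ (proj₂ AB)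
      A∩B-empty = proj₁ (proj₂ (proj₂ AB)) ; A∩B-nonempty = proj₂ (proj₂ (proj₂ AB))
      ∣A′∣≤ = proj₁ AB′ ; ∣B′∣≤ = proj₁ (proj₂ AB′)
      A′∩B′-empty = proj₁ (proj₂ (proj₂ AB′)) ; A′∩B′-nonempty = proj₂ (proj₂ (proj₂ AB′))

    Aᵢⱼ∩Bᵢⱼ-empty : ∀ i j → Empty (Aᵢⱼ i j ∩ Bᵢⱼ i j)
    Aᵢⱼ∩Bᵢⱼ-empty i j rewrite ⊎[]-∩ (A i) (B i) i (A′ j) (B′ j) = Empty-⊎[] (A∩B-empty i) (A′∩B′-empty j)

    ⊎-nonempty : ∀ {p q} → p <ₗₑₓ q → Nonempty (uncurry Aᵢⱼ p ∩ uncurry Bᵢⱼ q)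
    ⊎-nonempty {i , j} {i′ , j′} (inj₁ i<i′) with A∩B-nonempty i i′ i<i′
    ... | x , x∈ rewrite ++-∩ (A i) (B i′) (inBlock i (A′ j)) (inBlock i′ (B′ j′)) = _ , x∈p⇒x↑ˡ∈p++q x∈
    ⊎-nonempty {i , j} {.i , j′} (inj₂ (refl , j<j′)) with A′∩B′-nonempty j j′ j<j′
    ... | y , y∈ rewrite ⊎[]-∩ (A i) (B i) i (A′ j) (B′ j′) =
      _ , x∈q⇒m↑ʳx∈p++q (A i ∩ B i) (x∈s⇒combine∈inBlock i y∈)

    isSetSystem : IsSetSystem (a + c) (b + d) A⊗ B⊗
    isSetSystem =
      (λ x → ∣⊎[]∣≤ (A (i x)) (i x) (A′ (j x)) (∣A∣≤ (i x)) (∣A′∣≤ (j x))) ,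
      (λ x → ∣⊎[]∣≤ (B (i x)) (i x) (B′ (j x)) (∣B∣≤ (i x)) (∣B′∣≤ (j x))) ,
      (λ x → Aᵢⱼ∩Bᵢⱼ-empty (i x) (j x)) ,
      flatten-ordered {R = λ P Q → Nonempty (P ∩ Q)} Aᵢⱼ Bᵢⱼ ⊎-nonempty
      where i = Fin.quotient {N} N′ ; j = Fin.remainder {N} N′

  -- Without an index j₀ of the second system the sets B i would not appear in B⊗.
  Bᵢⱼ⊆⋃B⊗ : ∀ i j → Bᵢⱼ i j ⊆ ⋃B B⊗
  Bᵢⱼ⊆⋃B⊗ i j {x} x∈ = x∈⋃B⁺ B⊗ (combine i j) (subst (x ∈_) (sym (flatten-combine Bᵢⱼ i j)) x∈)

  ⋃B⊇ : Fin N′ → ⋃B B ++ copies N (⋃B B′) ⊆ ⋃B B⊗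
  ⋃B⊇ j₀ {x} x∈ with x∈p++q⁻ (⋃B B) x x∈
  ... | inj₁ (y , refl , y∈) with x∈⋃B⁻ B y∈
  ...   | i , y∈Bi = Bᵢⱼ⊆⋃B⊗ i j₀ (x∈p⇒x↑ˡ∈p++q y∈Bi)
  ⋃B⊇ j₀ {x} x∈ | inj₂ (z , refl , z∈) with x∈copies⁻ N (⋃B B′) z z∈
  ...   | i , y , refl , y∈ with x∈⋃B⁻ B′ y∈
  ...     | j , y∈B′j = Bᵢⱼ⊆⋃B⊗ i j (x∈q⇒m↑ʳx∈p++q (B i) (x∈s⇒combine∈inBlock i y∈B′j))

  ∣⋃B⊗∣≥ : Fin N′ → ∣ ⋃B B ∣ + N * ∣ ⋃B B′ ∣ ≤ ∣ ⋃B B⊗ ∣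
  ∣⋃B⊗∣≥ j₀ = subst (_≤ ∣ ⋃B B⊗ ∣)
    (trans (∣p++q∣≡∣p∣+∣q∣ (⋃B B) (copies N (⋃B B′))) (cong (∣ ⋃B B ∣ +_) (∣copies∣ N (⋃B B′))))
    (Subset.p⊆q⇒∣p∣≤∣q∣ (⋃B⊇ j₀))

setSystem-bound : ∀ (a b c d : ℕ) {m N} (A B : Fin N → Subset m) → IsSetSystem a b A B →
                  ∀ u₁ u₂ → IsUs (a + c) (b + d) u₁ → IsUs c d u₂ → N * u₂ + ∣ ⋃B B ∣ ≤ u₁
setSystem-bound a b c d {N = N} A B AB u₁ u₂ (_ , max₁) ((m′ , zero , _ , B′ , _ , refl) , _)
  rewrite Subset.∣⊥∣≡0 m′ | ℕ.*-zeroʳ N = max₁ A B (IsSetSystem-weaken AB)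
setSystem-bound a b c d {N = N} A B AB u₁ u₂ (_ , max₁) ((_ , suc _ , A′ , B′ , AB′ , refl) , _) =
  begin
    N * ∣ ⋃B B′ ∣ + ∣ ⋃B B ∣ ≡⟨ ℕ.+-comm (N * ∣ ⋃B B′ ∣) ∣ ⋃B B ∣ ⟩
    ∣ ⋃B B ∣ + N * ∣ ⋃B B′ ∣ ≤⟨ ∣⋃B⊗∣≥ zero ⟩
    ∣ ⋃B B⊗ ∣                ≤⟨ max₁ A⊗ B⊗ (isSetSystem AB AB′) ⟩
    u₁                       ∎
  where open SetSystemProduct A B A′ B′
        open ℕ.≤-Reasoning

module LinearAlgebra {c ℓ} (𝔽 : Field c ℓ) where
  open Field 𝔽 using (Carrier; _≈_; 0#; 1#; -_; 1≉0; +-cong; *-cong; +-assoc; +-identityˡ; +-identityʳ;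
                      *-assoc; *-identityˡ; zeroˡ; zeroʳ; distribˡ; distribʳ; +-group; ring;
                      +-commutativeSemigroup; *-commutativeSemigroup)
                   renaming (_+_ to _+ᶠ_; _*_ to _*ᶠ_; refl to ≈-refl; sym to ≈-sym; trans to ≈-trans;
                             reflexive to ≈-reflexive)
  open import Algebra.Properties.Ring ring using (-1*x≈-x)
  open import Algebra.Properties.Group +-group using (inverseˡ-unique)
  open import Algebra.Properties.CommutativeSemigroup +-commutativeSemigroup using (interchange)
  open import Algebra.Properties.CommutativeSemigroup *-commutativeSemigroup using (x∙yz≈y∙xz)
  open VectorSpaces 𝔽

  private variable p q : ℕ

  ≋-refl : ∀ {v : V n} → v ≋ v
  ≋-refl k = ≈-refl

  ≋-sym : ∀ {u v : V n} → u ≋ v → v ≋ u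
  ≋-sym u≋v k = ≈-sym (u≋v k)

  ≋-trans : ∀ {u v w : V n} → u ≋ v → v ≋ w → u ≋ w
  ≋-trans u≋v v≋w k = ≈-trans (u≋v k) (v≋w k)

  +V-cong : ∀ {u u′ v v′ : V n} → u ≋ u′ → v ≋ v′ → (u +V v) ≋ (u′ +V v′)
  +V-cong u≋u′ v≋v′ k = +-cong (u≋u′ k) (v≋v′ k)

  +V-identityˡ : ∀ (v : V n) → (0V +V v) ≋ v
  +V-identityˡ v k = +-identityˡ (v k)

  +V-identityʳ : ∀ (v : V n) → (v +V 0V) ≋ v
  +V-identityʳ v k = +-identityʳ (v k)

  ·V-zeroʳ : ∀ x → (x ·V 0V) ≋ 0V {n}
  ·V-zeroʳ x k = zeroʳ x

  u+v≋0⇒u≋-1·v : ∀ {u v : V n} → (u +V v) ≋ 0V → u ≋ ((- 1#) ·V v)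
  u+v≋0⇒u≋-1·v {v = v} u+v≋0 k = ≈-trans (inverseˡ-unique _ _ (u+v≋0 k)) (≈-sym (-1*x≈-x (v k)))

  lc-cong : ∀ (gs : List (V n)) {cs ds} → (∀ j → cs j ≈ ds j) → lc gs cs ≋ lc gs ds
  lc-cong List.[]       cs≈ds k = ≈-refl
  lc-cong (g List.∷ gs) cs≈ds k = +-cong (*-cong (cs≈ds zero) ≈-refl) (lc-cong gs (cs≈ds ∘ suc) k)

  lc-zero : ∀ (gs : List (V n)) → lc gs (λ _ → 0#) ≋ 0V
  lc-zero List.[]       k = ≈-refl
  lc-zero (g List.∷ gs) k = ≈-trans (+-cong (zeroˡ _) (lc-zero gs k)) (+-identityˡ 0#)

  lc-+ : ∀ (gs : List (V n)) cs ds → (lc gs cs +V lc gs ds) ≋ lc gs (λ j → cs j +ᶠ ds j)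
  lc-+ List.[]       cs ds k = +-identityˡ 0#
  lc-+ (g List.∷ gs) cs ds k =
    ≈-trans (interchange _ _ _ _) (+-cong (≈-sym (distribʳ (g k) _ _)) (lc-+ gs (cs ∘ suc) (ds ∘ suc) k))

  lc-· : ∀ (gs : List (V n)) x cs → (x ·V lc gs cs) ≋ lc gs (λ j → x *ᶠ cs j)
  lc-· List.[]       x cs k = zeroʳ x
  lc-· (g List.∷ gs) x cs k =
    ≈-trans (distribˡ x _ _) (+-cong (≈-sym (*-assoc x _ _)) (lc-· gs x (cs ∘ suc) k))

  ∈S-cong : ∀ (U : Subspace n) {v w} → v ∈S U → v ≋ w → w ∈S U
  ∈S-cong U (cs , lc≋v) v≋w = cs , ≋-trans lc≋v v≋w

  0∈S : ∀ (U : Subspace n) → 0V ∈S U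
  0∈S U = (λ _ → 0#) , lc-zero U

  +∈S : ∀ (U : Subspace n) {v w} → v ∈S U → w ∈S U → (v +V w) ∈S U
  +∈S U (cs , lc≋v) (ds , lc≋w) = (λ j → cs j +ᶠ ds j) , ≋-trans (≋-sym (lc-+ U cs ds)) (+V-cong lc≋v lc≋w)

  ·∈S : ∀ (U : Subspace n) x {v} → v ∈S U → (x ·V v) ∈S U
  ·∈S U x (cs , lc≋v) = (λ j → x *ᶠ cs j) , ≋-trans (≋-sym (lc-· U x cs)) (λ k → *-cong ≈-refl (lc≋v k))

  generator∈S : ∀ {U : Subspace n} {g} → g List.∈ U → g ∈S U
  generator∈S {U = u List.∷ U} (Any.here refl) = cs , λ k →
    ≈-trans (+-cong (*-identityˡ _) (lc-zero U k)) (+-identityʳ _)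
    where cs : Fin (suc (List.length U)) → Carrier
          cs zero    = 1#
          cs (suc j) = 0#
  generator∈S {U = u List.∷ U} (Any.there g∈U) with generator∈S g∈U
  ... | cs , lc≋g = cs′ , λ k → ≈-trans (+-cong (zeroˡ _) ≈-refl) (≈-trans (+-identityˡ _) (lc≋g k))
    where cs′ : Fin (suc (List.length U)) → Carrier
          cs′ zero    = 0#
          cs′ (suc j) = cs j

  lc∈S : ∀ {U : Subspace n} (W : Subspace n) → All (_∈S W) U → ∀ cs → lc U cs ∈S W
  lc∈S W []            cs = 0∈S W
  lc∈S W (u∈W ∷ U⊆W) cs = +∈S W (·∈S W (cs zero) u∈W) (lc∈S W U⊆W (cs ∘ suc))

  ∈S-trans : ∀ {U : Subspace n} (W : Subspace n) {v} → All (_∈S W) U → v ∈S U → v ∈S W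
  ∈S-trans W U⊆W (cs , lc≋v) = ∈S-cong W (lc∈S W U⊆W cs) lc≋v

  ⊆⇒All∈S : ∀ {U W : Subspace n} → (∀ {g} → g List.∈ U → g List.∈ W) → All (_∈S W) U
  ⊆⇒All∈S U⊆W = All.tabulate (generator∈S ∘ U⊆W)

  module _ {A : Set c} where
    indexˡ : ∀ (xs ys : List A) → Fin (List.length xs) → Fin (List.length (xs List.++ ys))
    indexˡ (x List.∷ xs) ys zero    = zero
    indexˡ (x List.∷ xs) ys (suc j) = suc (indexˡ xs ys j)

    indexʳ : ∀ (xs ys : List A) → Fin (List.length ys) → Fin (List.length (xs List.++ ys))
    indexʳ List.[]       ys j = j
    indexʳ (x List.∷ xs) ys j = suc (indexʳ xs ys j)

    index-++⁻ : ∀ (xs ys : List A) j → (∃ λ j′ → indexˡ xs ys j′ ≡ j) ⊎ (∃ λ j′ → indexʳ xs ys j′ ≡ j)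
    index-++⁻ List.[]       ys j       = inj₂ (j , refl)
    index-++⁻ (x List.∷ xs) ys zero    = inj₁ (zero , refl)
    index-++⁻ (x List.∷ xs) ys (suc j) with index-++⁻ xs ys j
    ... | inj₁ (j′ , refl) = inj₁ (suc j′ , refl)
    ... | inj₂ (j′ , refl) = inj₂ (j′ , refl)

    coeffs-++ : ∀ (xs ys : List A) → (Fin (List.length xs) → Carrier) → (Fin (List.length ys) → Carrier) →
                Fin (List.length (xs List.++ ys)) → Carrier
    coeffs-++ List.[]       ys cs ds         = ds
    coeffs-++ (x List.∷ xs) ys cs ds zero    = cs zero
    coeffs-++ (x List.∷ xs) ys cs ds (suc j) = coeffs-++ xs ys (cs ∘ suc) ds j

  lc-++ : ∀ (xs ys : List (V n)) cs →
          lc (xs List.++ ys) cs ≋ (lc xs (cs ∘ indexˡ xs ys) +V lc ys (cs ∘ indexʳ xs ys))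
  lc-++ List.[]       ys cs k = ≈-sym (+-identityˡ _)
  lc-++ (x List.∷ xs) ys cs k = ≈-trans (+-cong ≈-refl (lc-++ xs ys (cs ∘ suc) k)) (≈-sym (+-assoc _ _ _))

  lc-coeffs-++ : ∀ (xs ys : List (V n)) cs ds → lc (xs List.++ ys) (coeffs-++ xs ys cs ds) ≋ (lc xs cs +V lc ys ds)
  lc-coeffs-++ List.[]       ys cs ds k = ≈-sym (+-identityˡ _)
  lc-coeffs-++ (x List.∷ xs) ys cs ds k =
    ≈-trans (+-cong ≈-refl (lc-coeffs-++ xs ys (cs ∘ suc) ds k)) (≈-sym (+-assoc _ _ _))

  +∈S-++ : ∀ (xs ys : List (V n)) {u v} → u ∈S xs → v ∈S ys → (u +V v) ∈S (xs List.++ ys)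
  +∈S-++ xs ys (cs , lc≋u) (ds , lc≋v) =
    coeffs-++ xs ys cs ds , ≋-trans (lc-coeffs-++ xs ys cs ds) (+V-cong lc≋u lc≋v)

  ∈S-++⁺ˡ : ∀ (xs ys : List (V n)) {v} → v ∈S xs → v ∈S (xs List.++ ys)
  ∈S-++⁺ˡ xs ys v∈xs = ∈S-cong (xs List.++ ys) (+∈S-++ xs ys v∈xs (0∈S ys)) (+V-identityʳ _)

  ∈S-++⁺ʳ : ∀ (xs ys : List (V n)) {v} → v ∈S ys → v ∈S (xs List.++ ys)
  ∈S-++⁺ʳ xs ys v∈ys = ∈S-cong (xs List.++ ys) (+∈S-++ xs ys (0∈S xs) v∈ys) (+V-identityˡ _)

  ∈S-++⁻ : ∀ (xs ys : List (V n)) {v} → v ∈S (xs List.++ ys) →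
           ∃ λ u → ∃ λ w → u ∈S xs × w ∈S ys × v ≋ (u +V w)
  ∈S-++⁻ xs ys (cs , lc≋v) = _ , _ , (_ , ≋-refl) , (_ , ≋-refl) , ≋-trans (≋-sym lc≋v) (lc-++ xs ys cs)

  TrivialMeet-+≋0 : ∀ {xs ys : List (V n)} → TrivialMeet xs ys →
                    ∀ {u w} → u ∈S xs → w ∈S ys → (u +V w) ≋ 0V → u ≋ 0V × w ≋ 0V
  TrivialMeet-+≋0 {ys = ys} meet {u} {w} u∈xs w∈ys u+w≋0 = u≋0 , w≋0
    where
      u≋0 : u ≋ 0V
      u≋0 = meet u u∈xs (∈S-cong ys (·∈S ys (- 1#) w∈ys) (≋-sym (u+v≋0⇒u≋-1·v u+w≋0)))
      w≋0 : w ≋ 0V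
      w≋0 = ≋-trans (≋-sym (+V-identityˡ w)) (≋-trans (+V-cong (≋-sym u≋0) ≋-refl) u+w≋0)

  LinIndep-++ : ∀ {xs ys : List (V n)} → LinIndep xs → LinIndep ys → TrivialMeet xs ys → LinIndep (xs List.++ ys)
  LinIndep-++ {xs = xs} {ys} indep-xs indep-ys meet cs lc≋0 j
    with TrivialMeet-+≋0 {xs = xs} {ys} meet (cs ∘ indexˡ xs ys , ≋-refl) (cs ∘ indexʳ xs ys , ≋-refl)
                         (≋-trans (≋-sym (lc-++ xs ys cs)) lc≋0)
       | index-++⁻ xs ys j
  ... | u≋0 , _ | inj₁ (j′ , refl) = indep-xs (cs ∘ indexˡ xs ys) u≋0 j′
  ... | _ , w≋0 | inj₂ (j′ , refl) = indep-ys (cs ∘ indexʳ xs ys) w≋0 j′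

  NontrivialMeet-++⁺ˡ : ∀ (U W X Y : Subspace n) → NontrivialMeet U W → NontrivialMeet (U List.++ X) (W List.++ Y)
  NontrivialMeet-++⁺ˡ U W X Y (v , v∈U , v∈W , v≉0) = v , ∈S-++⁺ˡ U X v∈U , ∈S-++⁺ˡ W Y v∈W , v≉0

  NontrivialMeet-++⁺ʳ : ∀ (X Y U W : Subspace n) → NontrivialMeet U W → NontrivialMeet (X List.++ U) (Y List.++ W)
  NontrivialMeet-++⁺ʳ X Y U W (v , v∈U , v∈W , v≉0) = v , ∈S-++⁺ʳ X U v∈U , ∈S-++⁺ʳ Y W v∈W , v≉0

  HasDim-[] : ∀ {k} → HasDim {n} List.[] k → k ≡ 0
  HasDim-[] (List.[] , ∣L∣ , _) = sym ∣L∣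
  HasDim-[] ((g List.∷ L) , _ , indep , ((cs , lc≋g) ∷ _) , _) = ⊥-elim (1≉0 (indep e₀ lc≋0 zero))
    where
      e₀ : Fin (suc (List.length L)) → Carrier
      e₀ zero    = 1#
      e₀ (suc j) = 0#
      lc≋0 : lc (g List.∷ L) e₀ ≋ 0V
      lc≋0 k = ≈-trans (+-cong (≈-trans (*-cong ≈-refl (≈-sym (lc≋g k))) (zeroʳ 1#)) (lc-zero L k)) (+-identityˡ 0#)

  HasDim-++ : ∀ {U W : Subspace n} {k l} → TrivialMeet U W → HasDim U k → HasDim W l → HasDim (U List.++ W) (k + l)
  HasDim-++ {U = U} {W} meet (L , ∣L∣ , indep , L⊆U , U⊆L) (L′ , ∣L′∣ , indep′ , L′⊆W , W⊆L′) =
    L List.++ L′ ,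
    trans (Listₚ.length-++ L) (cong₂ _+_ ∣L∣ ∣L′∣) ,
    LinIndep-++ {xs = L} {L′} indep indep′ (λ v v∈L v∈L′ → meet v (∈S-trans U L⊆U v∈L) (∈S-trans W L′⊆W v∈L′)) ,
    Allₚ.++⁺ (All.map (∈S-++⁺ˡ U W) L⊆U) (All.map (∈S-++⁺ʳ U W) L′⊆W) ,
    Allₚ.++⁺ (All.map (∈S-++⁺ˡ L L′) U⊆L) (All.map (∈S-++⁺ʳ L L′) W⊆L′)

  HasDim-resp : ∀ {U W : Subspace n} {k} → All (_∈S W) U → All (_∈S U) W → HasDim U k → HasDim W k
  HasDim-resp {W = W} U⊆W W⊆U (L , ∣L∣ , indep , L⊆U , U⊆L) =
    L , ∣L∣ , indep , All.map (∈S-trans W U⊆W) L⊆U , All.map (∈S-trans L U⊆L) W⊆U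

  record IsLinear (f : V n → V p) : Set (c ⊔ ℓ) where
    field
      ≋-cong : ∀ {u v} → u ≋ v → f u ≋ f v
      +-hom  : ∀ u v → f (u +V v) ≋ (f u +V f v)
      ·-hom  : ∀ x v → f (x ·V v) ≋ (x ·V f v)

    0-hom : f 0V ≋ 0V
    0-hom = ≋-trans (≋-cong (λ k → ≈-sym (zeroˡ 0#))) (≋-trans (·-hom 0# 0V) (λ k → zeroˡ _))

    lc-kernel : ∀ {gs} → All (λ g → f g ≋ 0V) gs → ∀ cs → f (lc gs cs) ≋ 0V
    lc-kernel []               cs = 0-hom
    lc-kernel (fg≋0 ∷ fgs≋0) cs k = ≈-trans (+-hom _ _ k)
      (≈-trans (+-cong (≈-trans (·-hom _ _ k) (*-cong ≈-refl (fg≋0 k))) (lc-kernel fgs≋0 (cs ∘ suc) k))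
        (≈-trans (+-identityʳ _) (zeroʳ _)))

  precompose-linear : ∀ (σ : Fin p → Fin n) → IsLinear {n} {p} (_∘ σ)
  precompose-linear σ = record { ≋-cong = λ u≋v → u≋v ∘ σ ; +-hom = λ _ _ _ → ≈-refl ; ·-hom = λ _ _ _ → ≈-refl }

  id-linear : IsLinear {n} id
  id-linear = record { ≋-cong = id ; +-hom = λ _ _ → ≋-refl ; ·-hom = λ _ _ → ≋-refl }

  0-linear : IsLinear {n} {p} (const 0V)
  0-linear = record
    { ≋-cong = λ _ → ≋-refl ; +-hom = λ _ _ → ≋-sym (+V-identityˡ 0V) ; ·-hom = λ x _ → ≋-sym (·V-zeroʳ x) }

  ++ᵛ-linear : ∀ {f : V p → V n} {g : V p → V q} → IsLinear f → IsLinear g → IsLinear (λ v → f v ++ᵛ g v)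
  ++ᵛ-linear {n = n} {f = f} {g} f-lin g-lin = record { ≋-cong = ≋-cong′ ; +-hom = +-hom′ ; ·-hom = ·-hom′ }
    where
      module F = IsLinear f-lin
      module G = IsLinear g-lin
      ≋-cong′ : ∀ {u v} → u ≋ v → (f u ++ᵛ g u) ≋ (f v ++ᵛ g v)
      ≋-cong′ u≋v x with splitAt n x
      ... | inj₁ y = F.≋-cong u≋v y
      ... | inj₂ z = G.≋-cong u≋v z
      +-hom′ : ∀ u v → (f (u +V v) ++ᵛ g (u +V v)) ≋ ((f u ++ᵛ g u) +V (f v ++ᵛ g v))
      +-hom′ u v x with splitAt n x
      ... | inj₁ y = F.+-hom u v y
      ... | inj₂ z = G.+-hom u v z
      ·-hom′ : ∀ a v → (f (a ·V v) ++ᵛ g (a ·V v)) ≋ (a ·V (f v ++ᵛ g v))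
      ·-hom′ a v x with splitAt n x
      ... | inj₁ y = F.·-hom a v y
      ... | inj₂ z = G.·-hom a v z

  module _ {A B : Set c} (f : A → B) where
    index-map : ∀ (xs : List A) → Fin (List.length xs) → Fin (List.length (List.map f xs))
    index-map (x List.∷ xs) zero    = zero
    index-map (x List.∷ xs) (suc j) = suc (index-map xs j)

    index-map⁻ : ∀ (xs : List A) → Fin (List.length (List.map f xs)) → Fin (List.length xs)
    index-map⁻ (x List.∷ xs) zero    = zero
    index-map⁻ (x List.∷ xs) (suc j) = suc (index-map⁻ xs j)

    index-map⁻∘index-map : ∀ xs j → index-map⁻ xs (index-map xs j) ≡ j
    index-map⁻∘index-map (x List.∷ xs) zero    = refl
    index-map⁻∘index-map (x List.∷ xs) (suc j) = cong suc (index-map⁻∘index-map xs j)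

    index-map∘index-map⁻ : ∀ xs j → index-map xs (index-map⁻ xs j) ≡ j
    index-map∘index-map⁻ (x List.∷ xs) zero    = refl
    index-map∘index-map⁻ (x List.∷ xs) (suc j) = cong suc (index-map∘index-map⁻ xs j)

  lc-map : ∀ {f : V n → V p} → IsLinear f → ∀ gs cs → lc (List.map f gs) cs ≋ f (lc gs (cs ∘ index-map f gs))
  lc-map f-lin List.[]       cs = ≋-sym (IsLinear.0-hom f-lin)
  lc-map f-lin (g List.∷ gs) cs =
    ≋-trans (+V-cong (≋-sym (·-hom _ _)) (lc-map f-lin gs (cs ∘ suc))) (≋-sym (+-hom _ _))
    where open IsLinear f-lin

  record Embedding (n p : ℕ) : Set (c ⊔ ℓ) where
    field
      embed          : V n → V p
      retract        : V p → V n
      embed-linear   : IsLinear embed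
      retract-linear : IsLinear retract
      retract∘embed  : ∀ v → retract (embed v) ≋ v

    open IsLinear embed-linear public using () renaming (≋-cong to embed-cong; 0-hom to embed-0)
    open IsLinear retract-linear public using ()
      renaming (≋-cong to retract-cong; 0-hom to retract-0; lc-kernel to retract-lc-kernel)

    embed-∈S : ∀ U {v} → v ∈S U → embed v ∈S List.map embed U
    embed-∈S U (cs , lc≋v) = cs ∘ index-map⁻ embed U ,
      ≋-trans (lc-map embed-linear U _)
        (embed-cong (≋-trans (lc-cong U (λ j → ≈-reflexive (cong cs (index-map⁻∘index-map embed U j)))) lc≋v))

    embed-∈S⁻ : ∀ U {v} → v ∈S List.map embed U → ∃ λ w → w ∈S U × v ≋ embed w
    embed-∈S⁻ U (cs , lc≋v) = _ , (_ , ≋-refl) , ≋-trans (≋-sym lc≋v) (lc-map embed-linear U cs)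

    embed-≋0 : ∀ {v} → embed v ≋ 0V → v ≋ 0V
    embed-≋0 {v} ev≋0 = ≋-trans (≋-sym (retract∘embed v)) (≋-trans (retract-cong ev≋0) retract-0)

    embed-LinIndep : ∀ L → LinIndep L → LinIndep (List.map embed L)
    embed-LinIndep L indep cs lc≋0 j =
      subst (λ t → cs t ≈ 0#) (index-map∘index-map⁻ embed L j)
        (indep _ (embed-≋0 (≋-trans (≋-sym (lc-map embed-linear L cs)) lc≋0)) (index-map⁻ embed L j))

    embed-NontrivialMeet : ∀ U W → NontrivialMeet U W → NontrivialMeet (List.map embed U) (List.map embed W)
    embed-NontrivialMeet U W (v , v∈U , v∈W , v≉0) = embed v , embed-∈S U v∈U , embed-∈S W v∈W , v≉0 ∘ embed-≋0

    -- An element of the image is recovered by retract, which vanishes on ⟨ys⟩.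
    embed-TrivialMeet : ∀ L ys → All (λ y → retract y ≋ 0V) ys → TrivialMeet (List.map embed L) ys
    embed-TrivialMeet L ys retract-ys≋0 v v∈L (cs , lc≋v) with embed-∈S⁻ L v∈L
    ... | w , _ , v≋ew = ≋-trans v≋ew (≋-trans (embed-cong w≋0) embed-0)
      where
        w≋0 : w ≋ 0V
        w≋0 = ≋-trans (≋-sym (retract∘embed w))
                (≋-trans (retract-cong (≋-sym v≋ew))
                  (≋-trans (retract-cong (≋-sym lc≋v)) (retract-lc-kernel retract-ys≋0 cs)))

    embed-All∈S : ∀ {L} U → All (_∈S U) L → All (_∈S List.map embed U) (List.map embed L)
    embed-All∈S U = Allₚ.map⁺ ∘ All.map (embed-∈S U)

    embed-HasDim : ∀ U {k} → HasDim U k → HasDim (List.map embed U) k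
    embed-HasDim U (L , ∣L∣ , indep , L⊆U , U⊆L) =
      List.map embed L , trans (Listₚ.length-map embed L) ∣L∣ , embed-LinIndep L indep ,
      embed-All∈S U L⊆U , embed-All∈S L U⊆L

  open Embedding using (embed; retract)

  Orthogonal : Embedding n q → Embedding p q → Set (c ⊔ ℓ)
  Orthogonal κ ι = ∀ w → retract κ (embed ι w) ≋ 0V

  Orthogonal⇒retract≋0 : ∀ {κ : Embedding n q} {ι : Embedding p q} → Orthogonal κ ι →
                         ∀ W → All (λ y → retract κ y ≋ 0V) (List.map (embed ι) W)
  Orthogonal⇒retract≋0 κ⊥ι W = Allₚ.map⁺ (All.universal κ⊥ι W)

  Orthogonal⇒TrivialMeet : ∀ {κ : Embedding n q} {ι : Embedding p q} → Orthogonal κ ι →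
                           ∀ U W → TrivialMeet (List.map (embed κ) U) (List.map (embed ι) W)
  Orthogonal⇒TrivialMeet {κ = κ} {ι} κ⊥ι U W =
    Embedding.embed-TrivialMeet κ U (List.map (embed ι) W) (Orthogonal⇒retract≋0 {κ = κ} {ι} κ⊥ι W)

  ∈ΣS⁺ : ∀ {N} (B : Fin N → Subspace n) i {g} → g List.∈ B i → g List.∈ ΣS B
  ∈ΣS⁺ B i g∈ = List.∈-concat⁺′ g∈ (List.∈-tabulate⁺ i)

  ∈ΣS⁻ : ∀ {N} (B : Fin N → Subspace n) {g} → g List.∈ ΣS B → ∃ λ i → g List.∈ B i
  ∈ΣS⁻ B g∈ with List.∈-concat⁻′ (tabulate B) g∈
  ... | _ , g∈Bi , Bi∈ with List.∈-tabulate⁻ Bi∈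
  ...   | i , refl = i , g∈Bi

  copiesS : ∀ {K} → (Fin K → Embedding p q) → Subspace p → Subspace q
  copiesS ι W = ΣS λ i → List.map (embed (ι i)) W

  copiesS-retract≋0 : ∀ {K} {κ : Embedding n q} {ι : Fin K → Embedding p q} → (∀ i → Orthogonal κ (ι i)) →
                      ∀ W → All (λ y → retract κ y ≋ 0V) (copiesS ι W)
  copiesS-retract≋0 {κ = κ} {ι} κ⊥ι W =
    Allₚ.concat⁺ (Allₚ.tabulate⁺ λ i → Orthogonal⇒retract≋0 {κ = κ} {ι i} (κ⊥ι i) W)

  copiesS-HasDim : ∀ {K} (ι : Fin K → Embedding p q) → (∀ {i i′} → i ≢ i′ → Orthogonal (ι i) (ι i′)) →
                   ∀ {W l} → HasDim W l → HasDim (copiesS ι W) (K * l)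
  copiesS-HasDim {K = zero}  ι ι⊥ι dimW = List.[] , refl , (λ _ _ ()) , [] , []
  copiesS-HasDim {K = suc K} ι ι⊥ι {W} dimW =
    HasDim-++ (Embedding.embed-TrivialMeet (ι zero) W (copiesS (ι ∘ suc) W)
                 (copiesS-retract≋0 {κ = ι zero} {ι ∘ suc} (λ i → ι⊥ι λ ()) W))
      (Embedding.embed-HasDim (ι zero) W dimW)
      (copiesS-HasDim (ι ∘ suc) (λ i≢i′ → ι⊥ι (i≢i′ ∘ Fin.suc-injective)) dimW)

  record Biproduct (n₀ n₁ q : ℕ) : Set (c ⊔ ℓ) where
    field
      ι₀ : Embedding n₀ q
      ι₁ : Embedding n₁ q
      ι₀⊥ι₁ : Orthogonal ι₀ ι₁
      ι₁⊥ι₀ : Orthogonal ι₁ ι₀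

    private
      module ι₀ = Embedding ι₀
      module ι₁ = Embedding ι₁

    _⊕_ : Subspace n₀ → Subspace n₁ → Subspace q
    U ⊕ W = List.map ι₀.embed U List.++ List.map ι₁.embed W

    ⊕-∈S⁻ : ∀ U W {v} → v ∈S (U ⊕ W) → ∃ λ u → ∃ λ w → u ∈S U × w ∈S W × v ≋ (ι₀.embed u +V ι₁.embed w)
    ⊕-∈S⁻ U W v∈ with ∈S-++⁻ (List.map ι₀.embed U) (List.map ι₁.embed W) v∈
    ... | _ , _ , u∈ , w∈ , v≋ with ι₀.embed-∈S⁻ U u∈ | ι₁.embed-∈S⁻ W w∈
    ...   | u , u∈U , ≋ι₀u | w , w∈W , ≋ι₁w = u , w , u∈U , w∈W , ≋-trans v≋ (+V-cong ≋ι₀u ≋ι₁w)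

    retract₀-+ : ∀ u w → ι₀.retract (ι₀.embed u +V ι₁.embed w) ≋ u
    retract₀-+ u w = ≋-trans (IsLinear.+-hom ι₀.retract-linear _ _)
      (≋-trans (+V-cong (ι₀.retract∘embed u) (ι₀⊥ι₁ w)) (+V-identityʳ u))

    retract₁-+ : ∀ u w → ι₁.retract (ι₀.embed u +V ι₁.embed w) ≋ w
    retract₁-+ u w = ≋-trans (IsLinear.+-hom ι₁.retract-linear _ _)
      (≋-trans (+V-cong (ι₁⊥ι₀ u) (ι₁.retract∘embed w)) (+V-identityˡ w))

    -- Both components of a common vector are recovered by the retractions, so they lie in both meets.
    TrivialMeet-⊕ : ∀ {U U′ W W′} → TrivialMeet U U′ → TrivialMeet W W′ → TrivialMeet (U ⊕ W) (U′ ⊕ W′)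
    TrivialMeet-⊕ {U} {U′} {W} {W′} U∩U′≡0 W∩W′≡0 v v∈ v∈′
      with ⊕-∈S⁻ U W v∈ | ⊕-∈S⁻ U′ W′ v∈′
    ... | u , w , u∈U , w∈W , v≋ | u′ , w′ , u′∈U′ , w′∈W′ , v≋′ =
      ≋-trans v≋ (≋-trans (+V-cong (≋-trans (ι₀.embed-cong u≋0) ι₀.embed-0) (≋-trans (ι₁.embed-cong w≋0) ι₁.embed-0))
                          (+V-identityˡ 0V))
      where
        u≋u′ : u ≋ u′
        u≋u′ = ≋-trans (≋-sym (retract₀-+ u w)) (≋-trans (ι₀.retract-cong (≋-trans (≋-sym v≋) v≋′)) (retract₀-+ u′ w′))
        w≋w′ : w ≋ w′
        w≋w′ = ≋-trans (≋-sym (retract₁-+ u w)) (≋-trans (ι₁.retract-cong (≋-trans (≋-sym v≋) v≋′)) (retract₁-+ u′ w′))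
        u≋0 : u ≋ 0V
        u≋0 = U∩U′≡0 u u∈U (∈S-cong U′ u′∈U′ (≋-sym u≋u′))
        w≋0 : w ≋ 0V
        w≋0 = W∩W′≡0 w w∈W (∈S-cong W′ w′∈W′ (≋-sym w≋w′))

    HasDim-⊕ : ∀ {U W k l} → HasDim U k → HasDim W l → HasDim (U ⊕ W) (k + l)
    HasDim-⊕ {U} {W} dimU dimW =
      HasDim-++ (Orthogonal⇒TrivialMeet {κ = ι₀} {ι₁} ι₀⊥ι₁ U W) (ι₀.embed-HasDim U dimU) (ι₁.embed-HasDim W dimW)

    DimLe-⊕ : ∀ {U W a b} → DimLe U a → DimLe W b → DimLe (U ⊕ W) (a + b)
    DimLe-⊕ (k , dimU , k≤a) (l , dimW , l≤b) = k + l , HasDim-⊕ dimU dimW , ℕ.+-mono-≤ k≤a l≤b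

  -- V (n + N * n′) as V n followed by N blocks V n′, block i occupying the coordinates combine i y.
  module Coordinates (n n′ N : ℕ) where

    δ : ∀ {i i′ : Fin N} → Dec (i ≡ i′) → Carrier
    δ (yes _) = 1#
    δ (no _)  = 0#

    δ-yes : ∀ {i i′ : Fin N} (d : Dec (i ≡ i′)) → i ≡ i′ → ∀ x → (δ d *ᶠ x) ≈ x
    δ-yes (yes _)   _    x = *-identityˡ x
    δ-yes (no i≢i′) i≡i′ x = ⊥-elim (i≢i′ i≡i′)

    δ-no : ∀ {i i′ : Fin N} (d : Dec (i ≡ i′)) → i ≢ i′ → ∀ x → (δ d *ᶠ x) ≈ 0#
    δ-no (yes i≡i′) i≢i′ x = ⊥-elim (i≢i′ i≡i′)
    δ-no (no _)     _    x = zeroˡ x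

    onBlock : Fin N → V n′ → V (N * n′)
    onBlock i w z = δ (Fin.quotient {N} n′ z Fin.≟ i) *ᶠ w (Fin.remainder {N} n′ z)

    onBlock-linear : ∀ i → IsLinear (onBlock i)
    onBlock-linear i = record
      { ≋-cong = λ u≋v z → *-cong ≈-refl (u≋v _)
      ; +-hom  = λ u v z → distribˡ _ _ _
      ; ·-hom  = λ a v z → x∙yz≈y∙xz _ a _
      }

    onBlock-combine : ∀ i i′ w y → onBlock i w (combine i′ y) ≡ δ (i′ Fin.≟ i) *ᶠ w y
    onBlock-combine i i′ w y = cong (λ p → δ (proj₁ p Fin.≟ i) *ᶠ w (proj₂ p)) (Fin.remQuot-combine i′ y)

    0++onBlock-combine : ∀ i i′ w y → (0V ++ᵛ onBlock i′ w) (n ↑ʳ combine i y) ≡ δ (i Fin.≟ i′) *ᶠ w y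
    0++onBlock-combine i i′ w y =
      trans (Vecᶠ.lookup-++ʳ (0V {n}) (onBlock i′ w) (combine i y)) (onBlock-combine i′ i w y)

    Q : ℕ
    Q = n + N * n′

    first : Embedding n Q
    first = record
      { embed          = λ v → v ++ᵛ 0V
      ; retract        = _∘ (_↑ˡ N * n′)
      ; embed-linear   = ++ᵛ-linear id-linear 0-linear
      ; retract-linear = precompose-linear _
      ; retract∘embed  = λ v y → ≈-reflexive (Vecᶠ.lookup-++ˡ v 0V y)
      }

    block : Fin N → Embedding n′ Q
    block i = record
      { embed          = λ w → 0V ++ᵛ onBlock i w
      ; retract        = _∘ (n ↑ʳ_) ∘ combine i
      ; embed-linear   = ++ᵛ-linear 0-linear (onBlock-linear i)
      ; retract-linear = precompose-linear _
      ; retract∘embed  = λ w y →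
          ≈-trans (≈-reflexive (0++onBlock-combine i i w y)) (δ-yes (i Fin.≟ i) refl (w y))
      }

    block⊥block : ∀ {i i′} → i ≢ i′ → Orthogonal (block i) (block i′)
    block⊥block {i} {i′} i≢i′ w y =
      ≈-trans (≈-reflexive (0++onBlock-combine i i′ w y)) (δ-no (i Fin.≟ i′) i≢i′ (w y))

    first⊥block : ∀ i → Orthogonal first (block i)
    first⊥block i w y = ≈-reflexive (Vecᶠ.lookup-++ˡ 0V (onBlock i w) y)

    block⊥first : ∀ i → Orthogonal (block i) first
    block⊥first i v y = ≈-reflexive (Vecᶠ.lookup-++ʳ v 0V (combine i y))

    biproduct : Fin N → Biproduct n n′ Q
    biproduct i = record { ι₀ = first ; ι₁ = block i ; ι₀⊥ι₁ = first⊥block i ; ι₁⊥ι₀ = block⊥first i }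

    _⊕[_]_ : Subspace n → Fin N → Subspace n′ → Subspace Q
    U ⊕[ i ] W = Biproduct._⊕_ (biproduct i) U W

  IsVecSystem-weaken : ∀ {a b c d n N} {A B : Fin N → Subspace n} →
                       IsVecSystem a b A B → IsVecSystem (a + c) (b + d) A B
  IsVecSystem-weaken {a} {b} {c} {d} (dimA≤ , dimB≤ , trivial , nontrivial) =
    (λ i → let (k , dimAi , k≤a) = dimA≤ i in k , dimAi , ℕ.≤-trans k≤a (ℕ.m≤m+n a c)) ,
    (λ i → let (k , dimBi , k≤b) = dimB≤ i in k , dimBi , ℕ.≤-trans k≤b (ℕ.m≤m+n b d)) ,
    trivial , nontrivial

  module VecSystemProduct {n N n′ N′} (A B : Fin N → Subspace n) (A′ B′ : Fin N′ → Subspace n′) where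
    open Coordinates n n′ N

    Aᵢⱼ Bᵢⱼ : Fin N → Fin N′ → Subspace Q
    Aᵢⱼ i j = A i ⊕[ i ] A′ j
    Bᵢⱼ i j = B i ⊕[ i ] B′ j

    A⊗ B⊗ : Fin (N * N′) → Subspace Q
    A⊗ = flatten Aᵢⱼ
    B⊗ = flatten Bᵢⱼ

    module _ {a b c d} (AB : IsVecSystem a b A B) (AB′ : IsVecSystem c d A′ B′) where
      private
        dimA≤ = proj₁ AB ; dimB≤ = proj₁ (proj₂ AB)
        A∩B≡0 = proj₁ (proj₂ (proj₂ AB)) ; A∩B≢0 = proj₂ (proj₂ (proj₂ AB))
        dimA′≤ = proj₁ AB′ ; dimB′≤ = proj₁ (proj₂ AB′)
        A′∩B′≡0 = proj₁ (proj₂ (proj₂ AB′)) ; A′∩B′≢0 = proj₂ (proj₂ (proj₂ AB′))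

      ⊕-nontrivial : ∀ {p q} → p <ₗₑₓ q → NontrivialMeet (uncurry Aᵢⱼ p) (uncurry Bᵢⱼ q)
      ⊕-nontrivial {i , j} {i′ , j′} (inj₁ i<i′) =
        NontrivialMeet-++⁺ˡ (e₀ (A i)) (e₀ (B i′)) (e₁ (A′ j)) (e₂ (B′ j′))
          (Embedding.embed-NontrivialMeet first (A i) (B i′) (A∩B≢0 i i′ i<i′))
        where e₀ = List.map (embed first) ; e₁ = List.map (embed (block i)) ; e₂ = List.map (embed (block i′))
      ⊕-nontrivial {i , j} {.i , j′} (inj₂ (refl , j<j′)) =
        NontrivialMeet-++⁺ʳ (e₀ (A i)) (e₀ (B i)) (eᵢ (A′ j)) (eᵢ (B′ j′))
          (Embedding.embed-NontrivialMeet (block i) (A′ j) (B′ j′) (A′∩B′≢0 j j′ j<j′))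
        where e₀ = List.map (embed first) ; eᵢ = List.map (embed (block i))

      isVecSystem : IsVecSystem (a + c) (b + d) A⊗ B⊗
      isVecSystem =
        (λ x → Biproduct.DimLe-⊕ (biproduct (i x)) (dimA≤ (i x)) (dimA′≤ (j x))) ,
        (λ x → Biproduct.DimLe-⊕ (biproduct (i x)) (dimB≤ (i x)) (dimB′≤ (j x))) ,
        (λ x → Biproduct.TrivialMeet-⊕ (biproduct (i x)) {A (i x)} {B (i x)} {A′ (j x)} {B′ (j x)}
                 (A∩B≡0 (i x)) (A′∩B′≡0 (j x))) ,
        flatten-ordered {R = NontrivialMeet} Aᵢⱼ Bᵢⱼ ⊕-nontrivial
        where i = Fin.quotient {N} N′ ; j = Fin.remainder {N} N′

    generators : Subspace Q
    generators = List.map (embed first) (ΣS B) List.++ copiesS block (ΣS B′)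

    Bᵢⱼ⊆ΣS-B⊗ : ∀ i j {g} → g List.∈ Bᵢⱼ i j → g List.∈ ΣS B⊗
    Bᵢⱼ⊆ΣS-B⊗ i j g∈ = ∈ΣS⁺ B⊗ (combine i j) (subst (_ List.∈_) (sym (flatten-combine Bᵢⱼ i j)) g∈)

    generators⊆ΣS-B⊗ : Fin N′ → ∀ {g} → g List.∈ generators → g List.∈ ΣS B⊗
    generators⊆ΣS-B⊗ j₀ g∈ with List.∈-++⁻ (List.map (embed first) (ΣS B)) g∈
    ... | inj₁ g∈first with List.∈-map⁻ (embed first) g∈first
    ...   | b , b∈ , refl with ∈ΣS⁻ B b∈
    ...     | i , b∈Bi = Bᵢⱼ⊆ΣS-B⊗ i j₀ (List.∈-++⁺ˡ (List.∈-map⁺ (embed first) b∈Bi))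
    generators⊆ΣS-B⊗ j₀ g∈ | inj₂ g∈blocks with ∈ΣS⁻ (λ i → List.map (embed (block i)) (ΣS B′)) g∈blocks
    ...   | i , g∈blockᵢ with List.∈-map⁻ (embed (block i)) g∈blockᵢ
    ...     | b′ , b′∈ , refl with ∈ΣS⁻ B′ b′∈
    ...       | j , b′∈B′j =
      Bᵢⱼ⊆ΣS-B⊗ i j (List.∈-++⁺ʳ (List.map (embed first) (B i)) (List.∈-map⁺ (embed (block i)) b′∈B′j))

    Bᵢⱼ⊆generators : ∀ i j {g} → g List.∈ Bᵢⱼ i j → g List.∈ generators
    Bᵢⱼ⊆generators i j g∈ with List.∈-++⁻ (List.map (embed first) (B i)) g∈
    ... | inj₁ g∈first with List.∈-map⁻ (embed first) g∈first
    ...   | b , b∈Bi , refl = List.∈-++⁺ˡ (List.∈-map⁺ (embed first) (∈ΣS⁺ B i b∈Bi))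
    Bᵢⱼ⊆generators i j g∈ | inj₂ g∈block with List.∈-map⁻ (embed (block i)) g∈block
    ...   | b′ , b′∈B′j , refl = List.∈-++⁺ʳ (List.map (embed first) (ΣS B))
      (∈ΣS⁺ (λ i → List.map (embed (block i)) (ΣS B′)) i (List.∈-map⁺ (embed (block i)) (∈ΣS⁺ B′ j b′∈B′j)))

    ΣS-B⊗⊆generators : ∀ {g} → g List.∈ ΣS B⊗ → g List.∈ generators
    ΣS-B⊗⊆generators g∈ with ∈ΣS⁻ B⊗ g∈
    ... | x , g∈B⊗x = Bᵢⱼ⊆generators _ _ g∈B⊗x

    HasDim-generators : ∀ {k l} → HasDim (ΣS B) k → HasDim (ΣS B′) l → HasDim generators (k + N * l)
    HasDim-generators dimB dimB′ =
      HasDim-++ (Embedding.embed-TrivialMeet first (ΣS B) (copiesS block (ΣS B′))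
                  (copiesS-retract≋0 {κ = first} {block} first⊥block (ΣS B′)))
        (Embedding.embed-HasDim first (ΣS B) dimB)
        (copiesS-HasDim block block⊥block dimB′)

    HasDim-ΣS-B⊗ : ∀ {k l} → HasDim (ΣS B) k → HasDim (ΣS B′) l → Fin N′ → HasDim (ΣS B⊗) (k + N * l)
    HasDim-ΣS-B⊗ dimB dimB′ j₀ =
      HasDim-resp (⊆⇒All∈S (generators⊆ΣS-B⊗ j₀)) (⊆⇒All∈S ΣS-B⊗⊆generators) (HasDim-generators dimB dimB′)

  vecSystem-bound : ∀ (a b c d : ℕ) {n N} (A B : Fin N → Subspace n) → IsVecSystem a b A B →
                    ∀ k → HasDim (ΣS B) k → ∀ u₁ u₂ → IsUv (a + c) (b + d) u₁ → IsUv c d u₂ → N * u₂ + k ≤ u₁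
  vecSystem-bound a b c d {N = N} A B AB k dimB u₁ u₂ (_ , max₁) ((_ , zero , _ , _ , _ , dimB′) , _)
    rewrite HasDim-[] dimB′ | ℕ.*-zeroʳ N = max₁ A B (IsVecSystem-weaken AB) k dimB
  vecSystem-bound a b c d {N = N} A B AB k dimB u₁ u₂ (_ , max₁) ((_ , suc _ , A′ , B′ , AB′ , dimB′) , _) =
    begin
      N * u₂ + k ≡⟨ ℕ.+-comm (N * u₂) k ⟩
      k + N * u₂ ≤⟨ max₁ A⊗ B⊗ (isVecSystem AB AB′) (k + N * u₂) (HasDim-ΣS-B⊗ dimB dimB′ zero) ⟩
      u₁         ∎
    where open VecSystemProduct A B A′ B′
          open ℕ.≤-Reasoning

lemma11 : ∀ {c ℓ} (F : Field c ℓ) → IsInfinite F → (a b c′ d : ℕ) →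
    (∀ {m N} (A B : Fin N → Subset m) → IsSetSystem a b A B →
      ∀ u₁ u₂ → IsUs (a + c′) (b + d) u₁ → IsUs c′ d u₂ →
      N * u₂ + ∣ ⋃B B ∣ ≤ u₁)
    ×
    (∀ {n N} (A B : Fin N → VectorSpaces.Subspace F n) →
      VectorSpaces.IsVecSystem F a b A B →
      ∀ k → VectorSpaces.HasDim F (VectorSpaces.ΣS F B) k →
      ∀ u₁ u₂ → VectorSpaces.IsUv F (a + c′) (b + d) u₁ →
      VectorSpaces.IsUv F c′ d u₂ →
      N * u₂ + k ≤ u₁)
lemma11 F _ a b c′ d = setSystem-bound a b c′ d , LinearAlgebra.vecSystem-bound F a b c′ d
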